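{- With $t_m=m(m+1)/2$ denoting the $m$-th triangular number, $$ g(t_n,t_{n+1},t_{n+2};2)=\begin{cases} \dfrac{(5 n-3)(n+1)(n+2)}{4}-1&\text{if $n\ge 5$ is odd};\\[2mm] \dfrac{5 n(n+1)(n+2)}{4}-1&\text{if $n\ge 2$ is even}\,. \end{cases} $$
   Context: For positive integers $a_1,\dots,a_k$ with $\gcd(a_1,\dots,a_k)=1$ and an integer $N$, let $d(N;a_1,\dots,a_k)$ denote the number of $k$-tuples $(x_1,\dots,x_k)$ of nonnegative integers with $a_1x_1+\cdots+a_kx_k=N$. For a nonnegative integer $q$, $g(a_1,\dots,a_k;q)$ denotes the largest integer $N$ such that $d(N;a_1,\dots,a_k)\le q$. It is known that $\gcd(t_n,t_{n+1},t_{n+2})=1$. -}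

module Defs where

open import Data.Nat using (ℕ; zero; suc; _+_; _*_; _/_; _≤_; _<_; _≟_)
open import Data.List using (List; []; _∷_; length; filter; map; concatMap; upTo)
open import Data.Vec using (Vec; []; _∷_)
open import Relation.Binary.PropositionalEquality using (_≡_)

t : ℕ → ℕ
t m = (m * (m + 1)) / 2

lin : ∀ {k} → Vec ℕ k → Vec ℕ k → ℕ
lin [] [] = 0
lin (a ∷ as) (x ∷ xs) = a * x + lin as xs

box : ℕ → (k : ℕ) → List (Vec ℕ k)
box B zero = [] ∷ []
box B (suc k) = concatMap (λ x → map (x ∷_) (box B k)) (upTo (suc B))

-- d(N; a₁,…,a_k): number of k-tuples of nonnegative integers with Σ aᵢxᵢ = N.
-- For positive aᵢ every solution has xᵢ ≤ N, so enumerating the box [0,N]^k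
-- counts all solutions.
d : ∀ {k} → ℕ → Vec ℕ k → ℕ
d {k} N a = length (filter (λ x → lin a x ≟ N) (box N k))

IsG : ∀ {k} → Vec ℕ k → ℕ → ℕ → Set
IsG a q G = (d G a ≤ q) × (∀ N → G < N → q < d N a)
  where open import Data.Product using (_×_)

-- Write the three coefficients as PQ, QR, RS, with (P, Q, R, S) = (k, 2k+1, k+1, 2k+3) for n = 2k
-- and (2k+1, k+1, 2k+3, k+2) for n = 2k+1. Then PQ ≡ 1 (mod R) and RS ≡ 1 (mod Q), so a solution
-- (x, y, z) of N has x mod R and z mod Q forced by N, and solutions are linked by the exchanges
-- R·PQ = P·QR and Q·RS = S·QR. At the claimed G this leaves exactly two solutions. For N > G,
-- write RS = 1 + vQ: after fixing z = N mod Q, the number N / Q − v·z must be written as Px + Ry,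
-- and it exceeds a Frobenius bound for (P, R) by enough room for two exchanges (n even) or one
-- exchange of each kind (n odd), which yields three solutions.

module Submission where

open import Defs
open import Data.Nat
open import Data.Nat.Properties
open import Data.List using (List; []; _∷_; [_]; _++_; length; filter; map; upTo)
open import Data.List.Membership.Propositional using (_∈_)
open import Data.List.Membership.Propositional.Properties
  using (∈-concatMap⁺; ∈-map⁺; ∈-map⁻; ∈-upTo⁺; ∈-filter⁺; ∈-filter⁻)
open import Data.List.Relation.Unary.Any as Any using (here; there)
import Data.List.Relation.Unary.All as ListAll
import Data.List.Relation.Unary.All.Properties as ListAll
open import Data.List.Relation.Unary.AllPairs using (_∷_)
import Data.List.Relation.Unary.AllPairs as AllPairs
import Data.List.Relation.Unary.AllPairs.Properties as AllPairs
open import Data.List.Relation.Unary.Unique.Propositional using (Unique)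
import Data.List.Relation.Unary.Unique.Propositional.Properties as Unique
open import Data.List.Relation.Binary.Disjoint.Propositional using (Disjoint)
open import Data.Vec using (Vec; []; _∷_)
open import Data.Vec.Properties using (∷-injectiveˡ; ∷-injectiveʳ)
open import Data.Vec.Relation.Unary.All using (All; []; _∷_)
open import Data.Product using (_×_; _,_; proj₂; ∃; ∃₂)
open import Data.Sum using (_⊎_; inj₁; inj₂)
open import Data.Empty using (⊥-elim)
open import Relation.Binary.PropositionalEquality hiding ([_])
open import Data.Nat.DivMod
open import Data.Nat.Tactic.RingSolver using (solve; solve-∀)

-- Counting solutions

solutions : ∀ {k} → ℕ → Vec ℕ k → List (Vec ℕ k)
solutions {k} N a = filter (λ x → lin a x ≟ N) (box N k)

∈-box : ∀ {B k} {x : Vec ℕ k} → All (_≤ B) x → x ∈ box B k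
∈-box [] = here refl
∈-box {B} {suc k} {x ∷ xs} (x≤B ∷ xs≤B) =
  ∈-concatMap⁺ (λ y → map (y ∷_) (box B k)) (Any.map (λ { refl → ∈-map⁺ (x ∷_) (∈-box xs≤B) }) (∈-upTo⁺ (s≤s x≤B)))

box-unique : ∀ B k → Unique (box B k)
box-unique B zero = ListAll.[] ∷ AllPairs.[]
box-unique B (suc k) =
  Unique.concat⁺
    (ListAll.map⁺ (ListAll.universal (λ _ → Unique.map⁺ ∷-injectiveʳ (box-unique B k)) (upTo (suc B))))
    (AllPairs.map⁺ (AllPairs.map disjoint (Unique.upTo⁺ (suc B))))
  where
  disjoint : ∀ {x x′} → x ≢ x′ → Disjoint (map (x ∷_) (box B k)) (map (x′ ∷_) (box B k))
  disjoint x≢x′ (p , q) with ∈-map⁻ _ p | ∈-map⁻ _ q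
  ... | _ , _ , refl | _ , _ , eq = x≢x′ (∷-injectiveˡ eq)

lin-bounds : ∀ {k N} {a x : Vec ℕ k} → All (0 <_) a → lin a x ≤ N → All (_≤ N) x
lin-bounds {a = []} {[]} [] _ = []
lin-bounds {a = a ∷ _} {x ∷ _} (a>0 ∷ as>0) ax+rest≤N =
  ≤-trans (m≤n*m x a {{>-nonZero a>0}}) (m+n≤o⇒m≤o (a * x) ax+rest≤N)
  ∷ lin-bounds as>0 (m+n≤o⇒n≤o (a * x) ax+rest≤N)

∈-solutions : ∀ {k N} {a x : Vec ℕ k} → All (0 <_) a → lin a x ≡ N → x ∈ solutions N a
∈-solutions {N = N} {a} a>0 ax≡N =
  ∈-filter⁺ (λ x → lin a x ≟ N) (∈-box (lin-bounds a>0 (≤-reflexive ax≡N))) ax≡N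

solutions-unique : ∀ {k} N (a : Vec ℕ k) → Unique (solutions N a)
solutions-unique {k} N a = Unique.filter⁺ (λ x → lin a x ≟ N) (box-unique N k)

1≤length : ∀ {A : Set} {u : A} {xs} → u ∈ xs → 1 ≤ length xs
1≤length (here _)  = s≤s z≤n
1≤length (there _) = s≤s z≤n

2≤length : ∀ {A : Set} {u v : A} {xs} → u ∈ xs → v ∈ xs → u ≢ v → 2 ≤ length xs
2≤length (here refl) (here refl) u≢v = ⊥-elim (u≢v refl)
2≤length (here refl) (there v∈)  _   = s≤s (1≤length v∈)
2≤length (there u∈)  (here refl) _   = s≤s (1≤length u∈)
2≤length (there u∈)  (there v∈)  u≢v = m≤n⇒m≤1+n (2≤length u∈ v∈ u≢v)

3≤length : ∀ {A : Set} {u v w : A} {xs} → u ∈ xs → v ∈ xs → w ∈ xs →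
           u ≢ v → u ≢ w → v ≢ w → 3 ≤ length xs
3≤length (here refl) (here refl) _           u≢v _   _   = ⊥-elim (u≢v refl)
3≤length (here refl) _           (here refl) _   u≢w _   = ⊥-elim (u≢w refl)
3≤length _           (here refl) (here refl) _   _   v≢w = ⊥-elim (v≢w refl)
3≤length (here refl) (there v∈)  (there w∈)  _   _   v≢w = s≤s (2≤length v∈ w∈ v≢w)
3≤length (there u∈)  (here refl) (there w∈)  _   u≢w _   = s≤s (2≤length u∈ w∈ u≢w)
3≤length (there u∈)  (there v∈)  (here refl) u≢v _   _   = s≤s (2≤length u∈ v∈ u≢v)
3≤length (there u∈)  (there v∈)  (there w∈)  u≢v u≢w v≢w = m≤n⇒m≤1+n (3≤length u∈ v∈ w∈ u≢v u≢w v≢w)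

unique⊆pair⇒length≤2 : ∀ {A : Set} {u v : A} {xs} → Unique xs → (∀ {w} → w ∈ xs → w ≡ u ⊎ w ≡ v) →
                       length xs ≤ 2
unique⊆pair⇒length≤2 {xs = []}              _ _ = z≤n
unique⊆pair⇒length≤2 {xs = _ ∷ []}          _ _ = s≤s z≤n
unique⊆pair⇒length≤2 {xs = _ ∷ _ ∷ []}      _ _ = s≤s (s≤s z≤n)
unique⊆pair⇒length≤2 {xs = _ ∷ _ ∷ _ ∷ _} ((w₁≢w₂ ListAll.∷ w₁≢w₃ ListAll.∷ _) ∷ (w₂≢w₃ ListAll.∷ _) ∷ _) ⊆pair
  with ⊆pair (here refl) | ⊆pair (there (here refl)) | ⊆pair (there (there (here refl)))
... | inj₁ refl | inj₁ refl | _         = ⊥-elim (w₁≢w₂ refl)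
... | inj₂ refl | inj₂ refl | _         = ⊥-elim (w₁≢w₂ refl)
... | inj₁ refl | inj₂ refl | inj₁ refl = ⊥-elim (w₁≢w₃ refl)
... | inj₁ refl | inj₂ refl | inj₂ refl = ⊥-elim (w₂≢w₃ refl)
... | inj₂ refl | inj₁ refl | inj₁ refl = ⊥-elim (w₂≢w₃ refl)
... | inj₂ refl | inj₁ refl | inj₂ refl = ⊥-elim (w₁≢w₃ refl)

d≤2 : ∀ {k N} {a : Vec ℕ k} (u v : Vec ℕ k) → (∀ x → lin a x ≡ N → x ≡ u ⊎ x ≡ v) → d N a ≤ 2
d≤2 {N = N} {a} u v only-u-v = unique⊆pair⇒length≤2 (solutions-unique N a)
  (λ {x} x∈ → only-u-v x (proj₂ (∈-filter⁻ (λ x → lin a x ≟ N) {xs = box N _} x∈)))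

2<d : ∀ {k N} {a : Vec ℕ k} → All (0 <_) a → ∀ {u v w} → lin a u ≡ N → lin a v ≡ N → lin a w ≡ N →
      u ≢ v → u ≢ w → v ≢ w → 2 < d N a
2<d a>0 au≡N av≡N aw≡N =
  3≤length (∈-solutions a>0 au≡N) (∈-solutions a>0 av≡N) (∈-solutions a>0 aw≡N)

-- Representations by two generators

m*n≤o⇒m≤o/n : ∀ {m o} n .{{_ : NonZero n}} → m * n ≤ o → m ≤ o / n
m*n≤o⇒m≤o/n {m} {o} n mn≤o = subst (_≤ o / n) (m*n/n≡m m n) (/-monoˡ-≤ n mn≤o)

quotient-< : ∀ {n r r′ q q′} → r < r′ → r′ + q′ * n ≤ r + q * n → q′ < q
quotient-< {n} r<r′ le = ≰⇒> (λ q≤q′ → <⇒≱ (+-mono-<-≤ r<r′ (*-monoˡ-≤ n q≤q′)) le)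

RepresentableFrom : ℕ → ℕ → ℕ → Set
RepresentableFrom p q F = ∀ n → F ≤ n → ∃₂ λ x y → p * x + q * y ≡ n

consecutive-representable : ∀ p → RepresentableFrom (suc p) (suc (suc p)) (p * suc p)
consecutive-representable p n p[p+1]≤n = q ∸ r , r , (begin
    suc p * (q ∸ r) + suc (suc p) * r ≡⟨ regroup p (q ∸ r) r ⟩
    r + (q ∸ r + r) * suc p           ≡⟨ cong (λ w → r + w * suc p) (m∸n+n≡m r≤q) ⟩
    r + q * suc p                     ≡⟨ m≡m%n+[m/n]*n n (suc p) ⟨
    n                                 ∎)
  where
  open ≡-Reasoning
  q r : ℕ
  q = n / suc p
  r = n % suc p
  regroup : ∀ p w r → suc p * w + suc (suc p) * r ≡ r + (w + r) * suc p
  regroup = solve-∀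
  r≤q : r ≤ q
  r≤q = ≤-trans (s≤s⁻¹ (m%n<n n (suc p))) (m*n≤o⇒m≤o/n (suc p) p[p+1]≤n)

odd-gap-two-representable : ∀ k → RepresentableFrom (1 + 2 * k) (3 + 2 * k) (4 * k * suc k)
odd-gap-two-representable k n 4k[k+1]≤n = by-parity (r % 2) (m≡m%n+[m/n]*n r 2) (m%n<n r 2)
  where
  open ≡-Reasoning
  p q r s : ℕ
  p = 1 + 2 * k
  q = n / p
  r = n % p
  s = r / 2
  split-bound : ∀ k → 2 * k + 2 * k * (1 + 2 * k) ≡ 4 * k * suc k
  split-bound = solve-∀
  2k≤q : 2 * k ≤ q
  2k≤q = m*n≤o⇒m≤o/n p (≤-trans (m≤n+m _ (2 * k)) (≤-trans (≤-reflexive (split-bound k)) 4k[k+1]≤n))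
  n≡r+qp : n ≡ r + q * p
  n≡r+qp = m≡m%n+[m/n]*n n p
  even-regroup : ∀ k w s → (1 + 2 * k) * w + (3 + 2 * k) * s ≡ s * 2 + (w + s) * (1 + 2 * k)
  even-regroup = solve-∀
  odd-regroup : ∀ k w s → (1 + 2 * k) * w + (3 + 2 * k) * (s + k + 1) ≡ 1 + s * 2 + (w + (s + k + 2)) * (1 + 2 * k)
  odd-regroup = solve-∀
  -- Since 3 + 2k ≡ 2 (mod p), y is half of r, or of r + p when r is odd.
  by-parity : ∀ b → r ≡ b + s * 2 → b < 2 → ∃₂ λ x y → p * x + (3 + 2 * k) * y ≡ n
  by-parity 0 r≡2s _ = q ∸ s , s , (begin
    p * (q ∸ s) + (3 + 2 * k) * s ≡⟨ even-regroup k (q ∸ s) s ⟩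
    s * 2 + (q ∸ s + s) * p       ≡⟨ cong₂ (λ a b → a + b * p) (sym r≡2s) (m∸n+n≡m s≤q) ⟩
    r + q * p                     ≡⟨ n≡r+qp ⟨
    n                             ∎)
    where
    s≤k : s ≤ k
    s≤k = *-cancelʳ-≤ s k 2 (subst (s * 2 ≤_) (*-comm 2 k) (s≤s⁻¹ (subst (_< p) r≡2s (m%n<n n p))))
    s≤q : s ≤ q
    s≤q = ≤-trans s≤k (≤-trans (m≤m+n k (k + 0)) 2k≤q)
  by-parity 1 r≡1+2s _ = q ∸ (s + k + 2) , s + k + 1 , (begin
    p * (q ∸ (s + k + 2)) + (3 + 2 * k) * (s + k + 1) ≡⟨ odd-regroup k (q ∸ (s + k + 2)) s ⟩
    1 + s * 2 + (q ∸ (s + k + 2) + (s + k + 2)) * p   ≡⟨ cong₂ (λ a b → a + b * p) (sym r≡1+2s) (m∸n+n≡m s+k+2≤q) ⟩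
    r + q * p                                         ≡⟨ n≡r+qp ⟨
    n                                                 ∎)
    where
    1+s*2≤2k : 1 + s * 2 ≤ 2 * k
    1+s*2≤2k = s≤s⁻¹ (subst (_< p) r≡1+2s (m%n<n n p))
    s<k : s < k
    s<k = *-cancelʳ-< 2 s k (subst (s * 2 <_) (*-comm 2 k) 1+s*2≤2k)
    r<2k : r < 2 * k
    r<2k = subst (_< 2 * k) (sym r≡1+2s) (subst (suc s * 2 ≤_) (*-comm k 2) (*-monoˡ-≤ 2 s<k))
    2k<q : 2 * k < q
    2k<q = quotient-< r<2k (≤-trans (≤-reflexive (split-bound k)) (≤-trans 4k[k+1]≤n (≤-reflexive n≡r+qp)))
    s+k+2≤q : s + k + 2 ≤ q
    s+k+2≤q = subst (_≤ q) (+-comm 2 (s + k))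
      (≤-trans (s≤s (+-monoˡ-≤ k s<k)) (subst (λ w → suc (k + w) ≤ q) (+-identityʳ k) 2k<q))
  by-parity (suc (suc _)) _ (s≤s (s≤s ()))

-- Chained products PQ, QR, RS

triple : ℕ → ℕ → ℕ → Vec ℕ 3
triple x y z = x ∷ y ∷ z ∷ []

cong-triple : ∀ {x x′ y y′ z z′} → x ≡ x′ → y ≡ y′ → z ≡ z′ → triple x y z ≡ triple x′ y′ z′
cong-triple refl refl refl = refl

x-differs : ∀ {x x′ y y′ z z′} → x < x′ → triple x y z ≢ triple x′ y′ z′
x-differs x<x′ eq = <⇒≢ x<x′ (∷-injectiveˡ eq)

z-differs : ∀ {x x′ y y′ z z′} → z < z′ → triple x y z ≢ triple x′ y′ z′
z-differs z<z′ eq = <⇒≢ z<z′ (∷-injectiveˡ (∷-injectiveʳ (∷-injectiveʳ eq)))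

module ChainedProducts (P Q R S : ℕ) .{{_ : NonZero P}} .{{_ : NonZero Q}} .{{_ : NonZero R}} .{{_ : NonZero S}}
             (u v : ℕ) (PQ≡1+uR : P * Q ≡ 1 + u * R) (RS≡1+vQ : R * S ≡ 1 + v * Q) where

  coeffs : Vec ℕ 3
  coeffs = P * Q ∷ Q * R ∷ R * S ∷ []

  coeffs-positive : All (0 <_) coeffs
  coeffs-positive = >-nonZero⁻¹ (P * Q) {{m*n≢0 P Q}} ∷ >-nonZero⁻¹ (Q * R) {{m*n≢0 Q R}}
                  ∷ >-nonZero⁻¹ (R * S) {{m*n≢0 R S}} ∷ []

  L : ℕ → ℕ → ℕ → ℕ
  L x y z = lin coeffs (triple x y z)

  -- The ring solver treats as variables only the names it is given, so P, Q, R, S must be listed.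
  atoms : List ℕ → List ℕ
  atoms xs = xs ++ (P ∷ Q ∷ R ∷ S ∷ [])

  L-expand : ∀ x y z → L x y z ≡ P * Q * x + Q * R * y + R * S * z
  L-expand x y z = trans (cong (λ w → P * Q * x + (Q * R * y + w)) (+-identityʳ (R * S * z)))
                         (sym (+-assoc (P * Q * x) (Q * R * y) (R * S * z)))

  tradeˣ : ∀ x y z → L (x + R) y z ≡ L x (y + P) z
  tradeˣ x y z rewrite L-expand (x + R) y z | L-expand x (y + P) z =
    solve (atoms (x ∷ y ∷ z ∷ []))

  tradeᶻ : ∀ x y z → L x y (z + Q) ≡ L x (y + S) z
  tradeᶻ x y z rewrite L-expand x y (z + Q) | L-expand x (y + S) z = solve (atoms (x ∷ y ∷ z ∷ []))

  shiftˣ : ∀ i x y z → L (x + i * R) y z ≡ L x (y + i * P) z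
  shiftˣ i x y z rewrite L-expand (x + i * R) y z | L-expand x (y + i * P) z =
    solve (atoms (i ∷ x ∷ y ∷ z ∷ []))

  shiftᶻ : ∀ j x y z → L x y (z + j * Q) ≡ L x (y + j * S) z
  shiftᶻ j x y z rewrite L-expand x y (z + j * Q) | L-expand x (y + j * S) z =
    solve (atoms (j ∷ x ∷ y ∷ z ∷ []))

  L-mod-R : ∀ x y z → L x y z ≡ x + (u * x + Q * y + S * z) * R
  L-mod-R x y z rewrite L-expand x y z | PQ≡1+uR = solve (atoms (u ∷ x ∷ y ∷ z ∷ []))

  L-mod-Q : ∀ x y z → L x y z ≡ z + (P * x + R * y + v * z) * Q
  L-mod-Q x y z rewrite L-expand x y z | RS≡1+vQ = solve (atoms (v ∷ x ∷ y ∷ z ∷ []))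

  L%R : ∀ x y z → L x y z % R ≡ x % R
  L%R x y z = trans (cong (_% R) (L-mod-R x y z)) ([m+kn]%n≡m%n x (u * x + Q * y + S * z) R)

  L%Q : ∀ x y z → L x y z % Q ≡ z % Q
  L%Q x y z = trans (cong (_% Q) (L-mod-Q x y z)) ([m+kn]%n≡m%n z (P * x + R * y + v * z) Q)

  L-injectiveʸ : ∀ {x y y′ z} → L x y z ≡ L x y′ z → y ≡ y′
  L-injectiveʸ {x} {y} {y′} {z} eq =
    *-cancelˡ-≡ y y′ (Q * R) {{m*n≢0 Q R}}
      (+-cancelʳ-≡ (R * S * z + 0) (Q * R * y) (Q * R * y′) (+-cancelˡ-≡ (P * Q * x) _ _ eq))

  solution-shape : ∀ {x₀ y₀ z₀} → x₀ < R → z₀ < Q →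
                   ∀ {x y z} → L x y z ≡ L x₀ y₀ z₀ →
                   ∃₂ λ i j → x ≡ x₀ + i * R × z ≡ z₀ + j * Q × y + i * P + j * S ≡ y₀
  solution-shape {x₀} {y₀} {z₀} x₀<R z₀<Q {x} {y} {z} same =
    i , j , x≡ , z≡ , L-injectiveʸ (begin
      L x₀ (y + i * P + j * S) z₀   ≡⟨ shiftᶻ j x₀ (y + i * P) z₀ ⟨
      L x₀ (y + i * P) (z₀ + j * Q) ≡⟨ shiftˣ i x₀ y (z₀ + j * Q) ⟨
      L (x₀ + i * R) y (z₀ + j * Q) ≡⟨ cong₂ (λ x z → L x y z) x≡ z≡ ⟨
      L x y z                       ≡⟨ same ⟩
      L x₀ y₀ z₀                    ∎)
    where
    open ≡-Reasoning
    i j : ℕ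
    i = x / R
    j = z / Q
    x%R≡x₀ : x % R ≡ x₀
    x%R≡x₀ = begin
      x % R          ≡⟨ L%R x y z ⟨
      L x y z % R    ≡⟨ cong (_% R) same ⟩
      L x₀ y₀ z₀ % R ≡⟨ L%R x₀ y₀ z₀ ⟩
      x₀ % R         ≡⟨ m<n⇒m%n≡m x₀<R ⟩
      x₀             ∎
    z%Q≡z₀ : z % Q ≡ z₀
    z%Q≡z₀ = begin
      z % Q          ≡⟨ L%Q x y z ⟨
      L x y z % Q    ≡⟨ cong (_% Q) same ⟩
      L x₀ y₀ z₀ % Q ≡⟨ L%Q x₀ y₀ z₀ ⟩
      z₀ % Q         ≡⟨ m<n⇒m%n≡m z₀<Q ⟩
      z₀             ∎
    x≡ : x ≡ x₀ + i * R
    x≡ = trans (m≡m%n+[m/n]*n x R) (cong (_+ i * R) x%R≡x₀)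
    z≡ : z ≡ z₀ + j * Q
    z≡ = trans (m≡m%n+[m/n]*n z Q) (cong (_+ j * Q) z%Q≡z₀)

  L-quotient : ∀ N x y → v * (N % Q) + (P * x + R * y) ≡ N / Q →
               L x y (N % Q) ≡ N
  L-quotient N x y eq = begin
    L x y (N % Q)                                   ≡⟨ L-mod-Q x y (N % Q) ⟩
    N % Q + (P * x + R * y + v * (N % Q)) * Q       ≡⟨ cong (λ w → N % Q + w * Q) (trans (+-comm (P * x + R * y) (v * (N % Q))) eq) ⟩
    N % Q + N / Q * Q                               ≡⟨ m≡m%n+[m/n]*n N Q ⟨
    N                                               ∎
    where open ≡-Reasoning

  solution-above : ∀ {F} → RepresentableFrom P R F → ∀ X N →
                   v * pred Q + (P * X + F) ≤ N / Q → ∃₂ λ x y → L (x + X) y (N % Q) ≡ N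
  solution-above {F} representable X N bound =
    let x , y , Px+Ry≡n = representable (N / Q ∸ base) F≤n in
    x , y , L-quotient N (x + X) y (begin
      v * (N % Q) + (P * (x + X) + R * y) ≡⟨ cong (v * (N % Q) +_) (regroup P R x X y) ⟩
      v * (N % Q) + (P * X + (P * x + R * y)) ≡⟨ +-assoc (v * (N % Q)) (P * X) _ ⟨
      base + (P * x + R * y)                ≡⟨ cong (base +_) Px+Ry≡n ⟩
      base + (N / Q ∸ base)                 ≡⟨ m+[n∸m]≡n (m+n≤o⇒m≤o base base+F≤N/Q) ⟩
      N / Q                                 ∎)
    where
    open ≡-Reasoning
    base : ℕ
    base = v * (N % Q) + P * X
    base+F≤N/Q : base + F ≤ N / Q
    base+F≤N/Q = ≤-trans (≤-reflexive (+-assoc (v * (N % Q)) (P * X) F))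
                   (≤-trans (+-monoˡ-≤ (P * X + F) (*-monoʳ-≤ v (<⇒≤pred (m%n<n N Q)))) bound)
    F≤n : F ≤ N / Q ∸ base
    F≤n = m+n≤o⇒m≤o∸n F (subst (_≤ N / Q) (+-comm base F) base+F≤N/Q)
    regroup : ∀ a b x X y → a * (x + X) + b * y ≡ a * X + (a * x + b * y)
    regroup = solve-∀

  three-solutions-ˣˣ : ∀ {N} x y z → L (x + R + R) y z ≡ N → 2 < d N coeffs
  three-solutions-ˣˣ x y z sol =
    2<d coeffs-positive
      (trans (sym (tradeˣ x (y + P) z)) (trans (sym (tradeˣ (x + R) y z)) sol))
      (trans (sym (tradeˣ (x + R) y z)) sol)
      sol
      (x-differs x<x+R) (x-differs (<-trans x<x+R (m<m+n (x + R) R>0))) (x-differs (m<m+n (x + R) R>0))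
    where
    R>0 : R > 0
    R>0 = >-nonZero⁻¹ R
    x<x+R : x < x + R
    x<x+R = m<m+n x R>0

  three-solutions-ˣᶻ : ∀ {N} x y y′ z → y′ + S ≡ y + P → L (x + R) y z ≡ N → 2 < d N coeffs
  three-solutions-ˣᶻ x y y′ z y′+S≡y+P sol =
    2<d coeffs-positive
      (trans (sym (tradeˣ x y z)) sol)
      (trans (tradeᶻ x y′ z) (trans (cong (λ w → L x w z) y′+S≡y+P) (trans (sym (tradeˣ x y z)) sol)))
      sol
      (z-differs (m<m+n z (>-nonZero⁻¹ Q))) (x-differs x<x+R) (x-differs x<x+R)
    where
    x<x+R : x < x + R
    x<x+R = m<m+n x (>-nonZero⁻¹ R)

t-from-double : ∀ n {p} → n * (n + 1) ≡ p * 2 → t n ≡ p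
t-from-double n {p} eq = trans (cong (_/ 2) eq) (m*n/n≡m p 2)

m≡[1+n]*4⇒m/4∸1≡n : ∀ {m n} → m ≡ suc n * 4 → m / 4 ∸ 1 ≡ n
m≡[1+n]*4⇒m/4∸1≡n {m} {n} eq = cong (_∸ 1) (trans (cong (_/ 4) eq) (m*n/n≡m (suc n) 4))

module Even (m : ℕ) where

  open ChainedProducts (1 + m) (3 + 2 * m) (2 + m) (5 + 2 * m) (1 + 2 * m) (3 + m) (solve [ m ]) (solve [ m ])

  G : ℕ
  G = L (1 + m) (1 + 2 * m) (2 + 2 * m)

  suc-G : suc G ≡ 5 * (1 + m) * (2 + m) * (3 + 2 * m)
  suc-G = trans (cong suc (L-expand (1 + m) (1 + 2 * m) (2 + 2 * m))) (solve [ m ])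

  classify : ∀ i j {x y z} → x ≡ 1 + m + i * (2 + m) → z ≡ 2 + 2 * m + j * (3 + 2 * m) →
             y + i * (1 + m) + j * (5 + 2 * m) ≡ 1 + 2 * m →
             triple x y z ≡ triple (1 + m) (1 + 2 * m) (2 + 2 * m) ⊎ triple x y z ≡ triple (3 + 2 * m) m (2 + 2 * m)
  classify i (suc j) {y = y} _ _ eq = ⊥-elim (<⇒≱ (m<n+m (1 + 2 * m) {4} z<s)
    (m+n≤o⇒m≤o (5 + 2 * m) (m+n≤o⇒n≤o (y + i * (1 + m)) (≤-reflexive eq))))
  classify 0 0 {y = y} x≡ z≡ eq = inj₁ (cong-triple (trans x≡ (+-identityʳ (1 + m)))
    (trans (sym (trans (+-identityʳ (y + 0)) (+-identityʳ y))) eq) (trans z≡ (+-identityʳ (2 + 2 * m))))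
  classify 1 0 {y = y} x≡ z≡ eq = inj₂ (cong-triple (trans x≡ x₀+R)
    (+-cancelʳ-≡ (1 + m) y m (trans (sym (trans (+-identityʳ _) (cong (y +_) (+-identityʳ (1 + m))))) (trans eq y₀-split)))
    (trans z≡ (+-identityʳ (2 + 2 * m))))
    where
    x₀+R : 1 + m + 1 * (2 + m) ≡ 3 + 2 * m
    x₀+R = solve [ m ]
    y₀-split : 1 + 2 * m ≡ m + (1 + m)
    y₀-split = solve [ m ]
  classify (suc (suc i)) 0 {y = y} _ _ eq = ⊥-elim (<⇒≱ (≤-reflexive two-P) (begin
    1 + m + (1 + m)                          ≤⟨ +-monoʳ-≤ (1 + m) (m≤m+n (1 + m) (i * (1 + m))) ⟩
    1 + m + (1 + m + i * (1 + m))            ≤⟨ m≤n+m _ y ⟩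
    y + (1 + m + (1 + m + i * (1 + m)))      ≤⟨ m≤m+n _ 0 ⟩
    y + (1 + m + (1 + m + i * (1 + m))) + 0  ≡⟨ eq ⟩
    1 + 2 * m                                ∎))
    where
    open ≤-Reasoning
    two-P : 2 + 2 * m ≡ 1 + m + (1 + m)
    two-P = solve [ m ]

  solutions-of-G : ∀ s → lin coeffs s ≡ G →
                   s ≡ triple (1 + m) (1 + 2 * m) (2 + 2 * m) ⊎ s ≡ triple (3 + 2 * m) m (2 + 2 * m)
  solutions-of-G (x ∷ y ∷ z ∷ []) sol =
    let i , j , x≡ , z≡ , eq = solution-shape (n<1+n (1 + m)) (n<1+n (2 + 2 * m)) {x} {y} {z} sol
    in classify i j x≡ z≡ eq

  bound-split : 5 * (1 + m) * (2 + m) ≡ (3 + m) * (2 + 2 * m) + ((1 + m) * (2 + m + (2 + m)) + m * suc m)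
  bound-split = solve [ m ]

  above-G : ∀ N → G < N → 2 < d N coeffs
  above-G N G<N =
    let x , y , sol = solution-above (consecutive-representable m) (2 + m + (2 + m)) N
                        (subst (_≤ N / (3 + 2 * m)) bound-split
                          (m*n≤o⇒m≤o/n (3 + 2 * m) (subst (_≤ N) suc-G G<N)))
    in three-solutions-ˣˣ x y (N % (3 + 2 * m)) (trans (cong (λ w → L w y (N % (3 + 2 * m))) (+-assoc x (2 + m) (2 + m))) sol)

  isG : IsG coeffs 2 G
  isG = d≤2 {a = coeffs} _ _ solutions-of-G , above-G

  g-formula : ∀ n → n ≡ 2 + 2 * m →
              IsG (t n ∷ t (n + 1) ∷ t (n + 2) ∷ []) 2 ((5 * n * (n + 1) * (n + 2)) / 4 ∸ 1)
  g-formula _ refl = subst₂ (λ a g → IsG a 2 g) (sym t≡coeffs) (sym formula≡G) isG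
    where
    t≡coeffs : triple (t (2 + 2 * m)) (t (2 + 2 * m + 1)) (t (2 + 2 * m + 2)) ≡ coeffs
    t≡coeffs = cong-triple (t-from-double (2 + 2 * m) tₙ) (t-from-double (2 + 2 * m + 1) tₙ₊₁)
                           (t-from-double (2 + 2 * m + 2) tₙ₊₂)
      where
      tₙ : (2 + 2 * m) * (2 + 2 * m + 1) ≡ (1 + m) * (3 + 2 * m) * 2
      tₙ = solve [ m ]
      tₙ₊₁ : (2 + 2 * m + 1) * (2 + 2 * m + 1 + 1) ≡ (3 + 2 * m) * (2 + m) * 2
      tₙ₊₁ = solve [ m ]
      tₙ₊₂ : (2 + 2 * m + 2) * (2 + 2 * m + 2 + 1) ≡ (2 + m) * (5 + 2 * m) * 2
      tₙ₊₂ = solve [ m ]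
    formula≡G : (5 * (2 + 2 * m) * (2 + 2 * m + 1) * (2 + 2 * m + 2)) / 4 ∸ 1 ≡ G
    formula≡G = m≡[1+n]*4⇒m/4∸1≡n (trans quadruple (cong (_* 4) (sym suc-G)))
      where
      quadruple : 5 * (2 + 2 * m) * (2 + 2 * m + 1) * (2 + 2 * m + 2) ≡ 5 * (1 + m) * (2 + m) * (3 + 2 * m) * 4
      quadruple = solve [ m ]

module Odd (m : ℕ) where

  open ChainedProducts (5 + 2 * m) (3 + m) (7 + 2 * m) (4 + m) (2 + m) (9 + 2 * m) (solve [ m ]) (solve [ m ])

  G : ℕ
  G = L (6 + 2 * m) (4 + 2 * m) (2 + m)

  suc-G : suc G ≡ (11 + 5 * m) * (7 + 2 * m) * (3 + m)
  suc-G = trans (cong suc (L-expand (6 + 2 * m) (4 + 2 * m) (2 + m))) (solve [ m ])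

  classify : ∀ i j {x y z} → x ≡ 6 + 2 * m + i * (7 + 2 * m) → z ≡ 2 + m + j * (3 + m) →
             y + i * (5 + 2 * m) + j * (4 + m) ≡ 4 + 2 * m →
             triple x y z ≡ triple (6 + 2 * m) (4 + 2 * m) (2 + m) ⊎ triple x y z ≡ triple (6 + 2 * m) m (5 + 2 * m)
  classify (suc i) j {y = y} _ _ eq = ⊥-elim (<⇒≱ (m<n+m (4 + 2 * m) {1} z<s)
    (m+n≤o⇒m≤o (5 + 2 * m) (m+n≤o⇒n≤o y (m+n≤o⇒m≤o (y + (5 + 2 * m + i * (5 + 2 * m))) (≤-reflexive eq)))))
  classify 0 0 {y = y} x≡ z≡ eq = inj₁ (cong-triple (trans x≡ (+-identityʳ (6 + 2 * m)))
    (trans (sym (trans (+-identityʳ (y + 0)) (+-identityʳ y))) eq) (trans z≡ (+-identityʳ (2 + m))))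
  classify 0 1 {y = y} x≡ z≡ eq = inj₂ (cong-triple (trans x≡ (+-identityʳ (6 + 2 * m)))
    (+-cancelʳ-≡ (4 + m) y m (trans (sym (cong₂ _+_ (+-identityʳ y) (+-identityʳ (4 + m)))) (trans eq y₀-split)))
    (trans z≡ z₀+Q))
    where
    y₀-split : 4 + 2 * m ≡ m + (4 + m)
    y₀-split = solve [ m ]
    z₀+Q : 2 + m + 1 * (3 + m) ≡ 5 + 2 * m
    z₀+Q = solve [ m ]
  classify 0 (suc (suc j)) {y = y} _ _ eq =
    ⊥-elim (<⇒≱ (subst (4 + 2 * m <_) (sym two-S) (m<n+m (4 + 2 * m) {4} z<s)) (begin
    4 + m + (4 + m)                         ≤⟨ +-monoʳ-≤ (4 + m) (m≤m+n (4 + m) (j * (4 + m))) ⟩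
    4 + m + (4 + m + j * (4 + m))           ≤⟨ m≤n+m _ (y + 0) ⟩
    y + 0 + (4 + m + (4 + m + j * (4 + m))) ≡⟨ eq ⟩
    4 + 2 * m                               ∎))
    where
    open ≤-Reasoning
    two-S : 4 + m + (4 + m) ≡ 4 + (4 + 2 * m)
    two-S = solve [ m ]

  solutions-of-G : ∀ s → lin coeffs s ≡ G →
                   s ≡ triple (6 + 2 * m) (4 + 2 * m) (2 + m) ⊎ s ≡ triple (6 + 2 * m) m (5 + 2 * m)
  solutions-of-G (x ∷ y ∷ z ∷ []) sol =
    let i , j , x≡ , z≡ , eq = solution-shape (n<1+n (6 + 2 * m)) (n<1+n (2 + m)) {x} {y} {z} sol
    in classify i j x≡ z≡ eq

  bound-split : (11 + 5 * m) * (7 + 2 * m) ≡ (9 + 2 * m) * (2 + m) + ((5 + 2 * m) * (7 + 2 * m) + 4 * (2 + m) * (3 + m))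
  bound-split = solve [ m ]

  representable : RepresentableFrom (5 + 2 * m) (7 + 2 * m) (4 * (2 + m) * (3 + m))
  representable = subst₂ (λ p r → RepresentableFrom p r (4 * (2 + m) * (3 + m))) P≡ R≡ (odd-gap-two-representable (2 + m))
    where
    P≡ : 1 + 2 * (2 + m) ≡ 5 + 2 * m
    P≡ = solve [ m ]
    R≡ : 3 + 2 * (2 + m) ≡ 7 + 2 * m
    R≡ = solve [ m ]

  above-G : ∀ N → G < N → 2 < d N coeffs
  above-G N G<N =
    let x , y , sol = solution-above representable (7 + 2 * m) N
                        (subst (_≤ N / (3 + m)) bound-split (m*n≤o⇒m≤o/n (3 + m) (subst (_≤ N) suc-G G<N)))
    in three-solutions-ˣᶻ x y (y + (1 + m)) (N % (3 + m)) (y+P≡ y) sol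
    where
    y+P≡ : ∀ y → y + (1 + m) + (4 + m) ≡ y + (5 + 2 * m)
    y+P≡ y = trans (+-assoc y (1 + m) (4 + m)) (cong (y +_) P-split)
      where
      P-split : 1 + m + (4 + m) ≡ 5 + 2 * m
      P-split = solve [ m ]

  isG : IsG coeffs 2 G
  isG = d≤2 {a = coeffs} _ _ solutions-of-G , above-G

  g-formula : ∀ n → n ≡ 5 + 2 * m →
              IsG (t n ∷ t (n + 1) ∷ t (n + 2) ∷ []) 2 (((5 * n ∸ 3) * (n + 1) * (n + 2)) / 4 ∸ 1)
  g-formula _ refl = subst₂ (λ a g → IsG a 2 g) (sym t≡coeffs) (sym formula≡G) isG
    where
    t≡coeffs : triple (t (5 + 2 * m)) (t (5 + 2 * m + 1)) (t (5 + 2 * m + 2)) ≡ coeffs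
    t≡coeffs = cong-triple (t-from-double (5 + 2 * m) tₙ) (t-from-double (5 + 2 * m + 1) tₙ₊₁)
                           (t-from-double (5 + 2 * m + 2) tₙ₊₂)
      where
      tₙ : (5 + 2 * m) * (5 + 2 * m + 1) ≡ (5 + 2 * m) * (3 + m) * 2
      tₙ = solve [ m ]
      tₙ₊₁ : (5 + 2 * m + 1) * (5 + 2 * m + 1 + 1) ≡ (3 + m) * (7 + 2 * m) * 2
      tₙ₊₁ = solve [ m ]
      tₙ₊₂ : (5 + 2 * m + 2) * (5 + 2 * m + 2 + 1) ≡ (7 + 2 * m) * (4 + m) * 2
      tₙ₊₂ = solve [ m ]
    formula≡G : ((5 * (5 + 2 * m) ∸ 3) * (5 + 2 * m + 1) * (5 + 2 * m + 2)) / 4 ∸ 1 ≡ G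
    formula≡G = m≡[1+n]*4⇒m/4∸1≡n (trans (cong (λ a → a * (5 + 2 * m + 1) * (5 + 2 * m + 2)) 5n∸3)
                                     (trans quadruple (cong (_* 4) (sym suc-G))))
      where
      5n≡3+ : 5 * (5 + 2 * m) ≡ 3 + (22 + 10 * m)
      5n≡3+ = solve [ m ]
      5n∸3 : 5 * (5 + 2 * m) ∸ 3 ≡ 22 + 10 * m
      5n∸3 = trans (cong (_∸ 3) 5n≡3+) (m+n∸m≡n 3 (22 + 10 * m))
      quadruple : (22 + 10 * m) * (5 + 2 * m + 1) * (5 + 2 * m + 2) ≡ (11 + 5 * m) * (7 + 2 * m) * (3 + m) * 4
      quadruple = solve [ m ]

even-form : ∀ n → 2 ≤ n → n % 2 ≡ 0 → ∃ λ m → n ≡ 2 + 2 * m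
even-form 2 _ _ = 0 , refl
even-form 3 _ ()
even-form (suc (suc n@(suc (suc _)))) _ n%2≡0 =
  let m , n≡2+2m = even-form n (s≤s (s≤s z≤n)) n%2≡0 in suc m , trans (cong (2 +_) n≡2+2m) (step m)
  where
  step : ∀ m → 2 + (2 + 2 * m) ≡ 2 + 2 * suc m
  step = solve-∀

odd-form : ∀ n → 5 ≤ n → n % 2 ≡ 1 → ∃ λ m → n ≡ 5 + 2 * m
odd-form 1 (s≤s ()) _
odd-form 3 (s≤s (s≤s (s≤s ()))) _
odd-form 5 _ _ = 0 , refl
odd-form 6 _ ()
odd-form (suc (suc n@(suc (suc (suc (suc (suc _))))))) _ n%2≡1 =
  let m , n≡5+2m = odd-form n (s≤s (s≤s (s≤s (s≤s (s≤s z≤n))))) n%2≡1 in suc m , trans (cong (2 +_) n≡5+2m) (step m)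
  where
  step : ∀ m → 2 + (5 + 2 * m) ≡ 5 + 2 * suc m
  step = solve-∀

theorem3 : (∀ n → 5 ≤ n → n % 2 ≡ 1 →
    IsG (t n ∷ t (n + 1) ∷ t (n + 2) ∷ []) 2
    (((5 * n ∸ 3) * (n + 1) * (n + 2)) / 4 ∸ 1))
    × (∀ n → 2 ≤ n → n % 2 ≡ 0 →
    IsG (t n ∷ t (n + 1) ∷ t (n + 2) ∷ []) 2
    ((5 * n * (n + 1) * (n + 2)) / 4 ∸ 1))
theorem3 =
  (λ n 5≤n n-odd → let m , n≡5+2m = odd-form n 5≤n n-odd in Odd.g-formula m n n≡5+2m) ,
  (λ n 2≤n n-even → let m , n≡2+2m = even-form n 2≤n n-even in Even.g-formula m n n≡2+2m)
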